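{- For all $d\ge 2$, a $d$-permutation is a Baxter $d$-permutation if and only if all its direct projections of dimension $2$ and of dimension $3$ are well-sliced.
   Context: A $d$-permutation of size $n$ is a tuple $(\sigma_1,\dots,\sigma_{d-1})$ of permutations of $[n]$, with diagram $P=\{(i,\sigma_1(i),\dots,\sigma_{d-1}(i)):i\in[n]\}\subset[n]^d$. For an increasing sequence $i_1<\dots<i_{d'}$ in $[d]$ the direct projection is the $d'$-permutation with diagram $\{(p_{i_1},\dots,p_{i_{d'}}):p\in P\}$. Two points $p,q$ of a diagram are $k$-adjacent if their $k$-th coordinates differ by exactly one; the slice of such a pair is the closed box with opposite corners $p,q$, of type $k$ for each $k$ for which $p,q$ are $k$-adjacent. The direction of the slice is the sign vector of $q-p$ where $p_1<q_1$. Two slices intersect if their intersection has nonempty interior. A $d'$-permutation is well-sliced if every slice intersects exactly one slice of each type $k\in[d']$ and any two intersecting slices have the same direction. A Baxter $d$-permutation is one all of whose direct projections of every dimension $d'\le d$ (including itself) are well-sliced. -}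

module Defs where

open import Data.Nat using (ℕ; zero; suc; pred; _<_; _⊔_; _⊓_)
open import Data.Fin using (Fin; zero; suc; toℕ) renaming (_<_ to _<ᶠ_)
open import Data.Fin.Permutation using (Permutation′; _⟨$⟩ʳ_; id; flip; _∘ₚ_)
open import Data.Product using (Σ; _×_; _,_; ∃)
open import Data.Sum using (_⊎_)
open import Relation.Binary.PropositionalEquality using (_≡_)

-- A d-permutation of size n: a tuple (σ₁,…,σ_{d-1}) of permutations of [n].
-- Here [n] is Fin n and coordinates are indexed by Fin d (0-based).
DPerm : ℕ → ℕ → Set
DPerm d n = Fin (pred d) → Permutation′ n

-- The k-th coordinate map i ↦ (k-th coordinate of the diagram point with
-- first coordinate i):  coordinate 0 is the identity, coordinate k+1 is σ_{k+1}.
coordPerm : ∀ {d n} → DPerm d n → Fin d → Permutation′ n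
coordPerm {suc d} σ zero    = id
coordPerm {suc d} σ (suc k) = σ k

point : ∀ {d n} → DPerm d n → Fin n → Fin d → Fin n
point σ i k = coordPerm σ k ⟨$⟩ʳ i

StrictlyIncreasing : ∀ {d' d} → (Fin d' → Fin d) → Set
StrictlyIncreasing {d'} ι = ∀ (a b : Fin d') → a <ᶠ b → ι a <ᶠ ι b

-- Its diagram is {(p_{ι 0},…,p_{ι e}) : p ∈ P};
-- re-indexed by its first coordinate this is the (e+1)-permutation
-- τ_j = σ_{ι(j+1)} ∘ σ_{ι 0}⁻¹.
proj : ∀ {d n e} → DPerm d n → (Fin (suc e) → Fin d) → DPerm (suc e) n
proj σ ι j = flip (coordPerm σ (ι zero)) ∘ₚ coordPerm σ (ι (suc j))

module _ (d : ℕ) {n : ℕ} (σ : DPerm d n) where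

  Adjacent : Fin d → Fin n → Fin n → Set
  Adjacent k i j =
    (suc (toℕ (point σ i k)) ≡ toℕ (point σ j k)) ⊎ (suc (toℕ (point σ j k)) ≡ toℕ (point σ i k))

  IsSlice : Fin n → Fin n → Set
  IsSlice i j = (i <ᶠ j) × ∃ λ k → Adjacent k i j

  IsSliceOfType : Fin d → Fin n → Fin n → Set
  IsSliceOfType k i j = (i <ᶠ j) × Adjacent k i j

  lo hi : Fin n → Fin n → Fin d → ℕ
  lo i j k = toℕ (point σ i k) ⊓ toℕ (point σ j k)
  hi i j k = toℕ (point σ i k) ⊔ toℕ (point σ j k)

  -- The boxes of (i , j) and (i' , j') have intersection with nonempty interior:
  -- in every coordinate, max of lower ends < min of upper ends.
  Intersect : Fin n → Fin n → Fin n → Fin n → Set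
  Intersect i j i' j' = ∀ k → (lo i j k ⊔ lo i' j' k) < (hi i j k ⊓ hi i' j' k)

  -- direction: sign vector of q − p where p has the smaller first coordinate
  data Sgn : Set where
    neg zer pos : Sgn

  sgn : ℕ → ℕ → Sgn
  sgn zero    zero    = zer
  sgn zero    (suc b) = pos
  sgn (suc a) zero    = neg
  sgn (suc a) (suc b) = sgn a b

  direction : Fin n → Fin n → Fin d → Sgn
  direction i j k = sgn (toℕ (point σ i k)) (toℕ (point σ j k))

  SameDirection : Fin n → Fin n → Fin n → Fin n → Set
  SameDirection i j i' j' = ∀ k → direction i j k ≡ direction i' j' k

  IntersectsExactlyOne : Fin d → Fin n → Fin n → Set
  IntersectsExactlyOne k i j =
    Σ (Fin n) λ i' → Σ (Fin n) λ j' →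
      (IsSliceOfType k i' j' × Intersect i j i' j') ×
      (∀ i'' j'' → IsSliceOfType k i'' j'' → Intersect i j i'' j'' → (i'' ≡ i') × (j'' ≡ j'))

  WellSliced : Set
  WellSliced =
    (∀ i j → IsSlice i j → ∀ k → IntersectsExactlyOne k i j) ×
    (∀ i j i' j' → IsSlice i j → IsSlice i' j' → Intersect i j i' j' → SameDirection i j i' j')

Baxter : ∀ {d n} → DPerm d n → Set
Baxter {d} σ = ∀ (e : ℕ) (ι : Fin (suc e) → Fin d) → StrictlyIncreasing ι → WellSliced (suc e) (proj σ ι)

-- Every clause of well-slicedness is either about a single coordinate (adjacency, the type of
-- a slice) or a conjunction over the coordinates of the projection (intersection of boxes,
-- equality of direction vectors).  Viewing a projection as the original points together with a
-- set of coordinates, slices become unordered pairs of points and well-slicedness depends only on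
-- that set.  Given a slice of type a and a target type c, pick a second coordinate b with
-- c ∈ {a, b}.  The c-slice meeting the given slice along {a, b} is unique by the hypothesis on
-- {a, b}; for every further coordinate x the c-slice meeting it along {a, b, x} must be the same
-- one, so that slice meets it along all coordinates.  Likewise two intersecting slices have equal
-- or opposite directions on every {a, b, x}, and coordinate a, where the first slice has a
-- nonzero direction, forces the same choice for every x.  One-dimensional projections are
-- well-sliced because distinct unit intervals never overlap in their interiors.

module Submission where

open import Defs
open import Data.Nat using (ℕ; zero; suc; _≤_; _<_; _⊔_; _⊓_; s≤s; s≤s⁻¹; z≤n)
open import Data.Nat.Properties
  using (≤-antisym; ≤-trans; ≤-refl; n≤1+n; m≤n⇒m⊓n≡m; m≤n⇒m⊔n≡n; ⊓-comm; ⊔-comm;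
         ⊓-idem; ⊔-idem; m≤m⊔n; m≤n⊔m; m⊓n≤m; m⊓n≤n; 1+n≢n)
open import Data.Fin using (Fin; zero; suc; toℕ; _≟_; #_) renaming (_<_ to _<ᶠ_)
open import Data.Fin.Properties using (<-cmp; <-asym; <-irrefl; <-trans; toℕ-injective)
open import Data.Fin.Permutation using (Permutation′; _⟨$⟩ʳ_; _⟨$⟩ˡ_; inverseˡ; inverseʳ; flip)
open import Data.Product using (Σ; ∃; _×_; _,_; proj₁; proj₂; swap)
open import Data.Sum using (_⊎_; inj₁; inj₂)
open import Data.Empty using (⊥; ⊥-elim)
open import Function.Base using (id)
open import Function.Bundles using (_⇔_; mk⇔; Equivalence)
open import Relation.Nullary using (yes; no)
open import Relation.Binary.Definitions using (tri<; tri≈; tri>)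
open import Relation.Binary.PropositionalEquality

-- An index-free copy of Sgn d σ, so that directions in different diagrams can be compared.
data Sign : Set where
  neg zer pos : Sign

sign : ℕ → ℕ → Sign
sign zero    zero    = zer
sign zero    (suc b) = pos
sign (suc a) zero    = neg
sign (suc a) (suc b) = sign a b

opposite : Sign → Sign
opposite neg = pos
opposite zer = zer
opposite pos = neg

sign-swap : ∀ a b → sign b a ≡ opposite (sign a b)
sign-swap zero    zero    = refl
sign-swap zero    (suc b) = refl
sign-swap (suc a) zero    = refl
sign-swap (suc a) (suc b) = sign-swap a b

sign≡zer⇒≡ : ∀ a b → sign a b ≡ zer → a ≡ b
sign≡zer⇒≡ zero    zero    _ = refl
sign≡zer⇒≡ (suc a) (suc b) s = cong suc (sign≡zer⇒≡ a b s)

opposite-fixed⇒zer : ∀ s → opposite s ≡ s → s ≡ zer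
opposite-fixed⇒zer zer _ = refl

sign-< : ∀ {a b} → a < b → sign a b ≡ pos
sign-< {zero}  {suc b} _       = refl
sign-< {suc a} {suc b} (s≤s p) = sign-< p

sign-<≢sign-> : ∀ {a b a' b'} → a < b → a' < b' → sign a b ≢ sign b' a'
sign-<≢sign-> {a' = a'} {b'} a<b a'<b' rewrite sign-< a<b | sign-swap a' b' | sign-< a'<b' = λ ()

unitIntervals-overlap⇒≡ : ∀ {x y x' y'} → suc x ≡ y → suc x' ≡ y' →
                          ((x ⊓ y) ⊔ (x' ⊓ y')) < ((x ⊔ y) ⊓ (x' ⊔ y')) → x ≡ x'
unitIntervals-overlap⇒≡ {x} {x' = x'} refl refl o
  rewrite m≤n⇒m⊓n≡m (n≤1+n x) | m≤n⇒m⊓n≡m (n≤1+n x')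
        | m≤n⇒m⊔n≡n (n≤1+n x) | m≤n⇒m⊔n≡n (n≤1+n x') =
  ≤-antisym (≤-trans (m≤m⊔n x x') (≤-trans (s≤s⁻¹ o) (m⊓n≤n x x')))
            (≤-trans (m≤n⊔m x x') (≤-trans (s≤s⁻¹ o) (m⊓n≤m x x')))

wlog-< : ∀ {n} (P : Fin n → Fin n → Set) → (∀ {i j} → P j i → P i j) → (∀ {i j} → i <ᶠ j → P i j) →
         ∀ {i j} → i ≢ j → P i j
wlog-< P swapped ordered {i} {j} i≢j with <-cmp i j
... | tri< i<j _ _ = ordered i<j
... | tri≈ _ i≡j _ = ⊥-elim (i≢j i≡j)
... | tri> _ _ j<i = swapped (ordered j<i)

pair : ∀ {d} → Fin d → Fin d → Fin 2 → Fin d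
pair a b zero       = a
pair a b (suc zero) = b

triple : ∀ {d} → Fin d → Fin d → Fin d → Fin 3 → Fin d
triple a b c zero             = a
triple a b c (suc zero)       = b
triple a b c (suc (suc zero)) = c

pair-increasing : ∀ {d} {a b : Fin d} → a <ᶠ b → StrictlyIncreasing (pair a b)
pair-increasing a<b zero       (suc zero) _ = a<b
pair-increasing a<b (suc zero) (suc zero) (s≤s ())

triple-increasing : ∀ {d} {a b c : Fin d} → a <ᶠ b → b <ᶠ c → StrictlyIncreasing (triple a b c)
triple-increasing a<b b<c zero             (suc zero)       _ = a<b
triple-increasing a<b b<c zero             (suc (suc zero)) _ = <-trans a<b b<c
triple-increasing a<b b<c (suc zero)       (suc (suc zero)) _ = b<c
triple-increasing a<b b<c (suc zero)       (suc zero)       (s≤s ())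
triple-increasing a<b b<c (suc (suc zero)) (suc zero)       (s≤s ())
triple-increasing a<b b<c (suc (suc zero)) (suc (suc zero)) (s≤s (s≤s ()))

InImage : ∀ {K : Set} {d} → (K → Fin d) → Fin d → Set
InImage {K} ι c = ∃ λ (k : K) → ι k ≡ c

inImage : ∀ {K : Set} {d} {ι : K → Fin d} k → InImage ι (ι k)
inImage k = k , refl

_⊆ᶜ_ : ∀ {K K' : Set} {d} → (K' → Fin d) → (K → Fin d) → Set
ι' ⊆ᶜ ι = ∀ k' → InImage ι (ι' k')

triple-⊆ᶜ : ∀ {K : Set} {d} {ι : K → Fin d} {a b c} →
            InImage ι a → InImage ι b → InImage ι c → triple a b c ⊆ᶜ ι
triple-⊆ᶜ a b c zero             = a
triple-⊆ᶜ a b c (suc zero)       = b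
triple-⊆ᶜ a b c (suc (suc zero)) = c

typeIndex : ∀ {d} {a b c : Fin d} → c ≡ a ⊎ c ≡ b → Fin 3
typeIndex (inj₁ _) = zero
typeIndex (inj₂ _) = suc zero

triple-typeIndex : ∀ {d} {a b c : Fin d} (c∈ : c ≡ a ⊎ c ≡ b) x → triple a b x (typeIndex c∈) ≡ c
triple-typeIndex (inj₁ e) x = sym e
triple-typeIndex (inj₂ e) x = sym e

SamePair : ∀ {n} → Fin n → Fin n → Fin n → Fin n → Set
SamePair i j i' j' = (i' ≡ i × j' ≡ j) ⊎ (i' ≡ j × j' ≡ i)

samePair-swapˡ : ∀ {n} {i j i' j' : Fin n} → SamePair i j i' j' → SamePair j i i' j'
samePair-swapˡ (inj₁ (a , b)) = inj₂ (a , b)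
samePair-swapˡ (inj₂ (a , b)) = inj₁ (a , b)

samePair-swapʳ : ∀ {n} {i j i' j' : Fin n} → SamePair i j j' i' → SamePair i j i' j'
samePair-swapʳ (inj₁ (a , b)) = inj₂ (b , a)
samePair-swapʳ (inj₂ (a , b)) = inj₁ (b , a)

samePair-< : ∀ {n} {i j i' j' : Fin n} → i <ᶠ j → i' <ᶠ j' → SamePair i j i' j' → i' ≡ i × j' ≡ j
samePair-< i<j i'<j' (inj₁ e)             = e
samePair-< i<j i'<j' (inj₂ (refl , refl)) = ⊥-elim (<-asym i<j i'<j')

samePair-cong : ∀ {n} (h : Fin n → Fin n) {i j i' j'} → SamePair i j i' j' → SamePair (h i) (h j) (h i') (h j')
samePair-cong h (inj₁ (refl , refl)) = inj₁ (refl , refl)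
samePair-cong h (inj₂ (refl , refl)) = inj₂ (refl , refl)

-- Sliced ι is well-slicedness of the projection to the
-- coordinates ι, with slices as unordered pairs of points, so that no coordinate is singled out
-- to order them.
module Diagram {n d : ℕ} (u : Fin n → Fin d → ℕ) where

  Adj : Fin d → Fin n → Fin n → Set
  Adj c i j = (suc (u i c) ≡ u j c) ⊎ (suc (u j c) ≡ u i c)

  Overlap : Fin d → Fin n → Fin n → Fin n → Fin n → Set
  Overlap c i j i' j' = ((u i c ⊓ u j c) ⊔ (u i' c ⊓ u j' c)) < ((u i c ⊔ u j c) ⊓ (u i' c ⊔ u j' c))

  dir : Fin d → Fin n → Fin n → Sign
  dir c i j = sign (u i c) (u j c)

  module _ {K : Set} (ι : K → Fin d) where

    Slice : Fin n → Fin n → Set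
    Slice i j = Σ K λ k → Adj (ι k) i j

    Meet : Fin n → Fin n → Fin n → Fin n → Set
    Meet i j i' j' = ∀ k → Overlap (ι k) i j i' j'

    MeetsOne : Fin d → Fin n → Fin n → Set
    MeetsOne c i j = Σ (Fin n) λ i' → Σ (Fin n) λ j' →
      (Adj c i' j' × Meet i j i' j') ×
      (∀ i'' j'' → Adj c i'' j'' → Meet i j i'' j'' → SamePair i' j' i'' j'')

    SameDir : Fin n → Fin n → Fin n → Fin n → Set
    SameDir i j i' j' = ∀ k → dir (ι k) i j ≡ dir (ι k) i' j'

    Aligned : Fin n → Fin n → Fin n → Fin n → Set
    Aligned i j i' j' = SameDir i j i' j' ⊎ SameDir i j j' i'

    record Sliced : Set where
      field
        meetsOne : ∀ i j → Slice i j → ∀ k → MeetsOne (ι k) i j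
        aligned  : ∀ i j i' j' → Slice i j → Slice i' j' → Meet i j i' j' → Aligned i j i' j'

  adj-sym : ∀ {c i j} → Adj c i j → Adj c j i
  adj-sym (inj₁ p) = inj₂ p
  adj-sym (inj₂ p) = inj₁ p

  adj⇒values≢ : ∀ {c i j} → Adj c i j → u i c ≢ u j c
  adj⇒values≢ (inj₁ p) q = 1+n≢n (trans p (sym q))
  adj⇒values≢ (inj₂ p) q = 1+n≢n (trans p q)

  adj⇒≢ : ∀ {c i j} → Adj c i j → i ≢ j
  adj⇒≢ A refl = adj⇒values≢ A refl

  dir-swap : ∀ c i j → dir c j i ≡ opposite (dir c i j)
  dir-swap c i j = sign-swap (u i c) (u j c)

  adj⇒¬opposed : ∀ {c i j i' j'} → Adj c i j → dir c i j ≡ dir c i' j' → dir c i j ≡ dir c j' i' → ⊥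
  adj⇒¬opposed {c} {i} {j} {i'} {j'} A same opp =
    adj⇒values≢ A (sign≡zer⇒≡ (u i c) (u j c) (opposite-fixed⇒zer _ (begin
      opposite (dir c i j)   ≡⟨ cong opposite same ⟩
      opposite (dir c i' j') ≡⟨ sym (dir-swap c i' j') ⟩
      dir c j' i'            ≡⟨ sym opp ⟩
      dir c i j              ∎)))
    where open ≡-Reasoning

  overlap-swapˡ : ∀ {c i j i' j'} → Overlap c i j i' j' → Overlap c j i i' j'
  overlap-swapˡ {c} {i} {j} o rewrite ⊓-comm (u j c) (u i c) | ⊔-comm (u j c) (u i c) = o

  overlap-swapʳ : ∀ {c i j i' j'} → Overlap c i j i' j' → Overlap c i j j' i'
  overlap-swapʳ {c} {i' = i'} {j'} o rewrite ⊓-comm (u j' c) (u i' c) | ⊔-comm (u j' c) (u i' c) = o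

  overlap-samePair : ∀ {c i j i' j' i'' j''} → SamePair i' j' i'' j'' → Overlap c i j i'' j'' → Overlap c i j i' j'
  overlap-samePair (inj₁ (refl , refl)) o = o
  overlap-samePair (inj₂ (refl , refl)) o = overlap-swapʳ o

  overlap-refl : ∀ {c i j} → Adj c i j → Overlap c i j i j
  overlap-refl {c} {i} {j} (inj₁ p) = unit (u i c) p
    where
      unit : ∀ x {y} → suc x ≡ y → ((x ⊓ y) ⊔ (x ⊓ y)) < ((x ⊔ y) ⊓ (x ⊔ y))
      unit x refl
        rewrite m≤n⇒m⊓n≡m (n≤1+n x) | m≤n⇒m⊔n≡n (n≤1+n x) | ⊓-idem (suc x) | ⊔-idem x = ≤-refl
  overlap-refl (inj₂ p) = overlap-swapˡ (overlap-swapʳ (overlap-refl (inj₁ p)))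

  module Swaps {K : Set} {ι : K → Fin d} where

    slice⇒≢ : ∀ {i j} → Slice ι i j → i ≢ j
    slice⇒≢ (_ , A) = adj⇒≢ A

    slice-sym : ∀ {i j} → Slice ι i j → Slice ι j i
    slice-sym (k , A) = k , adj-sym A

    meet-swapˡ : ∀ {i j i' j'} → Meet ι i j i' j' → Meet ι j i i' j'
    meet-swapˡ I k = overlap-swapˡ (I k)

    meet-swapʳ : ∀ {i j i' j'} → Meet ι i j i' j' → Meet ι i j j' i'
    meet-swapʳ I k = overlap-swapʳ (I k)

    meetsOne-swap : ∀ {c i j} → MeetsOne ι c j i → MeetsOne ι c i j
    meetsOne-swap (i' , j' , (A , I) , U) =
      i' , j' , (A , meet-swapˡ I) , λ i'' j'' A'' I'' → U i'' j'' A'' (meet-swapˡ I'')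

    sameDir-swap : ∀ {i j i' j'} → SameDir ι j i i' j' → SameDir ι i j j' i'
    sameDir-swap {i} {j} {i'} {j'} f k = begin
      dir (ι k) i j                ≡⟨ dir-swap (ι k) j i ⟩
      opposite (dir (ι k) j i)     ≡⟨ cong opposite (f k) ⟩
      opposite (dir (ι k) i' j')   ≡⟨ sym (dir-swap (ι k) i' j') ⟩
      dir (ι k) j' i'              ∎
      where open ≡-Reasoning

    aligned-swapˡ : ∀ {i j i' j'} → Aligned ι j i i' j' → Aligned ι i j i' j'
    aligned-swapˡ (inj₁ f) = inj₂ (sameDir-swap f)
    aligned-swapˡ (inj₂ f) = inj₁ (sameDir-swap f)

    aligned-swapʳ : ∀ {i j i' j'} → Aligned ι i j j' i' → Aligned ι i j i' j'
    aligned-swapʳ (inj₁ f) = inj₂ f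
    aligned-swapʳ (inj₂ f) = inj₁ f

  module _ {K K' : Set} {ι : K → Fin d} {ι' : K' → Fin d} (ι'⊆ι : ι' ⊆ᶜ ι) where

    slice-mono : ∀ {i j} → Slice ι' i j → Slice ι i j
    slice-mono {i} {j} (k' , A) with ι'⊆ι k'
    ... | k , e = k , subst (λ c → Adj c i j) (sym e) A

    meet-mono : ∀ {i j i' j'} → Meet ι i j i' j' → Meet ι' i j i' j'
    meet-mono {i} {j} {i'} {j'} I k' with ι'⊆ι k'
    ... | k , e = subst (λ c → Overlap c i j i' j') e (I k)

    sameDir-mono : ∀ {i j i' j'} → SameDir ι i j i' j' → SameDir ι' i j i' j'
    sameDir-mono {i} {j} {i'} {j'} f k' with ι'⊆ι k'
    ... | k , e = subst (λ c → dir c i j ≡ dir c i' j') e (f k)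

    aligned-mono : ∀ {i j i' j'} → Aligned ι i j i' j' → Aligned ι' i j i' j'
    aligned-mono (inj₁ f) = inj₁ (sameDir-mono f)
    aligned-mono (inj₂ f) = inj₂ (sameDir-mono f)

  sliced-sameImage : ∀ {K K' : Set} {ι : K → Fin d} {ι' : K' → Fin d} →
                     ι ⊆ᶜ ι' → ι' ⊆ᶜ ι → Sliced ι → Sliced ι'
  sliced-sameImage {ι = ι} {ι'} ι⊆ι' ι'⊆ι S = record
    { meetsOne = λ i j s k' →
        subst (λ c → MeetsOne ι' c i j) (proj₂ (ι'⊆ι k'))
              (transfer (Sliced.meetsOne S i j (slice-mono ι'⊆ι s) (proj₁ (ι'⊆ι k'))))
    ; aligned = λ i j i' j' s s' I →
        aligned-mono ι'⊆ι (Sliced.aligned S i j i' j' (slice-mono ι'⊆ι s) (slice-mono ι'⊆ι s')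
                                                     (meet-mono ι⊆ι' I))
    }
    where
      transfer : ∀ {c i j} → MeetsOne ι c i j → MeetsOne ι' c i j
      transfer (i' , j' , (A , I) , U) =
        i' , j' , (A , meet-mono ι'⊆ι I) , λ i'' j'' A'' I'' → U i'' j'' A'' (meet-mono ι⊆ι' I'')

  module _ (injective : ∀ c {i j} → u i c ≡ u j c → i ≡ j) where

    upward-overlap⇒≡ : ∀ {c i j i' j'} → suc (u i c) ≡ u j c → suc (u i' c) ≡ u j' c →
                       Overlap c i j i' j' → i' ≡ i × j' ≡ j
    upward-overlap⇒≡ {c} a b o =
      sym (injective c e) , sym (injective c (trans (sym a) (trans (cong suc e) b)))
      where e = unitIntervals-overlap⇒≡ a b o

    adj-overlap⇒samePair : ∀ {c i j i' j'} → Adj c i j → Adj c i' j' → Overlap c i j i' j' → SamePair i j i' j'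
    adj-overlap⇒samePair (inj₁ a) (inj₁ b) o = inj₁ (upward-overlap⇒≡ a b o)
    adj-overlap⇒samePair (inj₁ a) (inj₂ b) o = inj₂ (swap (upward-overlap⇒≡ a b (overlap-swapʳ o)))
    adj-overlap⇒samePair (inj₂ a) (inj₁ b) o = inj₂ (upward-overlap⇒≡ a b (overlap-swapˡ o))
    adj-overlap⇒samePair (inj₂ a) (inj₂ b) o =
      inj₁ (swap (upward-overlap⇒≡ a b (overlap-swapˡ (overlap-swapʳ o))))

    sliced-single : (ι : Fin 1 → Fin d) → Sliced ι
    sliced-single ι = record { meetsOne = meetsOne ; aligned = aligned }
      where
        meetsOne : ∀ i j → Slice ι i j → ∀ k → MeetsOne ι (ι k) i j
        meetsOne i j (zero , A) zero =
          i , j , (A , λ { zero → overlap-refl A }) , λ i'' j'' A'' I'' → adj-overlap⇒samePair A A'' (I'' zero)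
        aligned : ∀ i j i' j' → Slice ι i j → Slice ι i' j' → Meet ι i j i' j' → Aligned ι i j i' j'
        aligned i j i' j' (zero , A) (zero , A') I with adj-overlap⇒samePair A A' (I zero)
        ... | inj₁ (refl , refl) = inj₁ λ _ → refl
        ... | inj₂ (refl , refl) = inj₂ λ _ → refl

  module _ {a b : Fin d} (T : ∀ x → Sliced (triple a b x)) {K : Set} {ι : K → Fin d}
           (a∈ : InImage ι a) (b∈ : InImage ι b) where

    private
      triple⊆ : ∀ {x} → InImage ι x → triple a b x ⊆ᶜ ι
      triple⊆ = triple-⊆ᶜ a∈ b∈

      triple⊆triple : ∀ x → triple a b a ⊆ᶜ triple a b x
      triple⊆triple x = triple-⊆ᶜ (inImage zero) (inImage (suc zero)) (inImage zero)

      sliceIn : ∀ {x c i j} → c ≡ a ⊎ c ≡ b → Adj c i j → Slice (triple a b x) i j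
      sliceIn {x} {i = i} {j} c∈ A = typeIndex c∈ , subst (λ c → Adj c i j) (sym (triple-typeIndex c∈ x)) A

      partnerIn : ∀ {i j c} x → Adj a i j → c ≡ a ⊎ c ≡ b → MeetsOne (triple a b x) c i j
      partnerIn {i} {j} x A c∈ = subst (λ c → MeetsOne (triple a b x) c i j) (triple-typeIndex c∈ x)
                                       (Sliced.meetsOne (T x) i j (zero , A) (typeIndex c∈))

    meetsOne-fromTriples : ∀ {i j c} → Adj a i j → c ≡ a ⊎ c ≡ b → MeetsOne ι c i j
    meetsOne-fromTriples {i} {j} {c} A c∈ with partnerIn a A c∈
    ... | i' , j' , (A' , _) , unique =
      i' , j' , (A' , meet) , λ i'' j'' A'' I'' → unique i'' j'' A'' (meet-mono (triple⊆ a∈) I'')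
      where
        -- the partner found in the triple (a, b, ι k) also meets (i, j) along (a, b),
        -- so it is the partner (i', j') and witnesses its overlap in coordinate ι k
        meet : Meet ι i j i' j'
        meet k with partnerIn (ι k) A c∈
        ... | p , q , (Apq , Ipq) , _ =
          overlap-samePair (unique p q Apq (meet-mono (triple⊆triple (ι k)) Ipq)) (Ipq (suc (suc zero)))

    aligned-fromTriples : ∀ {i j i' j' c} → Adj a i j → Adj c i' j' → c ≡ a ⊎ c ≡ b →
                          Meet ι i j i' j' → Aligned ι i j i' j'
    aligned-fromTriples {i} {j} {i'} {j'} A A' c∈ I = orient (alignedIn (proj₁ a∈))
      where
        alignedIn : ∀ k → Aligned (triple a b (ι k)) i j i' j'
        alignedIn k = Sliced.aligned (T (ι k)) i j i' j' (zero , A) (sliceIn c∈ A') (meet-mono (triple⊆ (inImage k)) I)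
        -- coordinate a separates the two orientations since (i, j) is a-adjacent
        sameAt : ∀ {x y} → SameDir (triple a b x) i j i' j' → Aligned (triple a b y) i j i' j' →
                 dir y i j ≡ dir y i' j'
        sameAt f (inj₁ g) = g (suc (suc zero))
        sameAt f (inj₂ g) = ⊥-elim (adj⇒¬opposed A (f zero) (g zero))
        oppositeAt : ∀ {x y} → SameDir (triple a b x) i j j' i' → Aligned (triple a b y) i j i' j' →
                     dir y i j ≡ dir y j' i'
        oppositeAt f (inj₁ g) = ⊥-elim (adj⇒¬opposed A (g zero) (f zero))
        oppositeAt f (inj₂ g) = g (suc (suc zero))
        orient : ∀ {x} → Aligned (triple a b x) i j i' j' → Aligned ι i j i' j'
        orient (inj₁ f) = inj₁ λ k → sameAt f (alignedIn k)
        orient (inj₂ f) = inj₂ λ k → oppositeAt f (alignedIn k)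

  sliced-fromTriples : (∀ a b x → a ≢ b → Sliced (triple a b x)) →
                       ∀ {K : Set} {ι : K → Fin d} (k₁ k₂ : K) → ι k₁ ≢ ι k₂ → Sliced ι
  sliced-fromTriples T {K} {ι} k₁ k₂ k₁≢k₂ = record { meetsOne = meetsOne ; aligned = aligned }
    where
      partner : ∀ k₀ k → Σ K λ k' → ι k₀ ≢ ι k' × (ι k ≡ ι k₀ ⊎ ι k ≡ ι k')
      partner k₀ k with ι k ≟ ι k₀ | ι k₁ ≟ ι k₀
      ... | no  k≢k₀ | _         = k  , (λ e → k≢k₀ (sym e)) , inj₂ refl
      ... | yes k≡k₀ | yes k₁≡k₀ = k₂ , (λ e → k₁≢k₂ (trans k₁≡k₀ e)) , inj₁ k≡k₀
      ... | yes k≡k₀ | no  k₁≢k₀ = k₁ , (λ e → k₁≢k₀ (sym e)) , inj₁ k≡k₀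

      meetsOne : ∀ i j → Slice ι i j → ∀ k → MeetsOne ι (ι k) i j
      meetsOne i j (k₀ , A) k with partner k₀ k
      ... | k' , a≢b , c∈ = meetsOne-fromTriples (λ x → T _ _ x a≢b) (inImage k₀) (inImage k') A c∈

      aligned : ∀ i j i' j' → Slice ι i j → Slice ι i' j' → Meet ι i j i' j' → Aligned ι i j i' j'
      aligned i j i' j' (k₀ , A) (k , A') I with partner k₀ k
      ... | k' , a≢b , c∈ = aligned-fromTriples (λ x → T _ _ x a≢b) (inImage k₀) (inImage k') A A' c∈ I

module _ {n d d' : ℕ} {K : Set} {ι : K → Fin d} {ι' : K → Fin d'}
         {v : Fin n → Fin d → ℕ} {w : Fin n → Fin d' → ℕ} (π : Permutation′ n)
         (w≡v∘π : ∀ i k → w i (ι' k) ≡ v (π ⟨$⟩ʳ i) (ι k)) where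

  private
    module V = Diagram v
    module W = Diagram w

    to from : Fin n → Fin n
    to i   = π ⟨$⟩ʳ i
    from i = π ⟨$⟩ˡ i

    adj→ : ∀ {k i j} → W.Adj (ι' k) i j → V.Adj (ι k) (to i) (to j)
    adj→ {k} {i} {j} A rewrite w≡v∘π i k | w≡v∘π j k = A

    adj← : ∀ {k i j} → V.Adj (ι k) (to i) (to j) → W.Adj (ι' k) i j
    adj← {k} {i} {j} A rewrite w≡v∘π i k | w≡v∘π j k = A

    meet→ : ∀ {i j i' j'} → W.Meet ι' i j i' j' → V.Meet ι (to i) (to j) (to i') (to j')
    meet→ {i} {j} {i'} {j'} I k with I k
    ... | o rewrite w≡v∘π i k | w≡v∘π j k | w≡v∘π i' k | w≡v∘π j' k = o

    meet← : ∀ {i j i' j'} → V.Meet ι (to i) (to j) (to i') (to j') → W.Meet ι' i j i' j'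
    meet← {i} {j} {i'} {j'} I k with I k
    ... | o rewrite w≡v∘π i k | w≡v∘π j k | w≡v∘π i' k | w≡v∘π j' k = o

    dir≡ : ∀ k i j → W.dir (ι' k) i j ≡ V.dir (ι k) (to i) (to j)
    dir≡ k i j rewrite w≡v∘π i k | w≡v∘π j k = refl

    sameDir← : ∀ {i j i' j'} → V.SameDir ι (to i) (to j) (to i') (to j') → W.SameDir ι' i j i' j'
    sameDir← {i} {j} {i'} {j'} f k = trans (dir≡ k i j) (trans (f k) (sym (dir≡ k i' j')))

  sliced-relabel : V.Sliced ι → W.Sliced ι'
  sliced-relabel S = record { meetsOne = meetsOne ; aligned = aligned }
    where
      meetsOne : ∀ i j → W.Slice ι' i j → ∀ k → W.MeetsOne ι' (ι' k) i j
      meetsOne i j (k₀ , A) k with V.Sliced.meetsOne S (to i) (to j) (k₀ , adj→ A) k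
      ... | p , q , (Apq , Ipq) , unique =
        from p , from q ,
        (adj← (subst₂ (V.Adj (ι k)) (sym (inverseʳ π)) (sym (inverseʳ π)) Apq) ,
         meet← (subst₂ (V.Meet ι (to i) (to j)) (sym (inverseʳ π)) (sym (inverseʳ π)) Ipq)) ,
        λ i'' j'' A'' I'' → subst₂ (SamePair (from p) (from q)) (inverseˡ π) (inverseˡ π)
                                   (samePair-cong from (unique (to i'') (to j'') (adj→ A'') (meet→ I'')))

      aligned : ∀ i j i' j' → W.Slice ι' i j → W.Slice ι' i' j' → W.Meet ι' i j i' j' → W.Aligned ι' i j i' j'
      aligned i j i' j' (k , A) (k' , A') I
        with V.Sliced.aligned S (to i) (to j) (to i') (to j') (k , adj→ A) (k' , adj→ A') (meet→ I)
      ... | inj₁ f = inj₁ (sameDir← f)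
      ... | inj₂ f = inj₂ (sameDir← f)

coords : ∀ d {n} → DPerm d n → Fin n → Fin d → ℕ
coords d σ i c = toℕ (point σ i c)

coords-injective : ∀ {d n} (σ : DPerm d n) c {i j} → coords d σ i c ≡ coords d σ j c → i ≡ j
coords-injective σ c e = trans (sym (inverseˡ π)) (trans (cong (π ⟨$⟩ˡ_) (toℕ-injective e)) (inverseˡ π))
  where π = coordPerm σ c

module _ {e n : ℕ} (σ : DPerm (suc e) n) where

  private
    D = suc e

  open Diagram (coords D σ)
  open Swaps {ι = id}

  private

    toSgn : Sign → Sgn D σ
    toSgn neg = neg
    toSgn zer = zer
    toSgn pos = pos

    toSgn-sign : ∀ a b → toSgn (sign a b) ≡ sgn D σ a b
    toSgn-sign zero    zero    = refl
    toSgn-sign zero    (suc b) = refl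
    toSgn-sign (suc a) zero    = refl
    toSgn-sign (suc a) (suc b) = toSgn-sign a b

    toSgn-injective : ∀ {s t} → toSgn s ≡ toSgn t → s ≡ t
    toSgn-injective {neg} {neg} _ = refl
    toSgn-injective {zer} {zer} _ = refl
    toSgn-injective {pos} {pos} _ = refl

    toSgn-dir : ∀ i j k → toSgn (dir k i j) ≡ direction D σ i j k
    toSgn-dir i j k = toSgn-sign (coords D σ i k) (coords D σ j k)

    sameDirection⇒sameDir : ∀ {i j i' j'} → SameDirection D σ i j i' j' → SameDir id i j i' j'
    sameDirection⇒sameDir {i} {j} {i'} {j'} f k =
      toSgn-injective (trans (toSgn-dir i j k) (trans (f k) (sym (toSgn-dir i' j' k))))

    sameDir⇒sameDirection : ∀ {i j i' j'} → SameDir id i j i' j' → SameDirection D σ i j i' j'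
    sameDir⇒sameDirection {i} {j} {i'} {j'} f k =
      trans (sym (toSgn-dir i j k)) (trans (cong toSgn (f k)) (toSgn-dir i' j' k))

  wellSliced⇒sliced : WellSliced D σ → Sliced id
  wellSliced⇒sliced (W₁ , W₂) = record
    { meetsOne = λ i j s → wlog-< MeetsOneFrom (λ h s k → meetsOne-swap {c = k} (h (slice-sym s) k))
                                  meetsOne (slice⇒≢ s) s
    ; aligned  = λ i j i' j' s s' →
        wlog-< AlignedFrom (λ h s s' I → aligned-swapˡ (h (slice-sym s) s' (meet-swapˡ I))) aligned (slice⇒≢ s) s s'
    }
    where
      MeetsOneFrom : Fin n → Fin n → Set
      MeetsOneFrom i j = Slice id i j → ∀ k → MeetsOne id k i j

      meetsOne : ∀ {i j} → i <ᶠ j → MeetsOneFrom i j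
      meetsOne {i} {j} i<j s k with W₁ i j (i<j , s) k
      ... | i' , j' , ((_ , A') , I) , unique = i' , j' , (A' , I) , λ i'' j'' A'' →
        wlog-< (λ i'' j'' → Adj k i'' j'' → Meet id i j i'' j'' → SamePair i' j' i'' j'')
               (λ h A I → samePair-swapʳ (h (adj-sym {c = k} A) (meet-swapʳ I)))
               (λ i''<j'' A I → inj₁ (unique _ _ (i''<j'' , A) I))
               (adj⇒≢ {c = k} A'') A''

      AlignedFrom : Fin n → Fin n → Set
      AlignedFrom i j = Slice id i j → ∀ {i' j'} → Slice id i' j' → Meet id i j i' j' → Aligned id i j i' j'

      aligned : ∀ {i j} → i <ᶠ j → AlignedFrom i j
      aligned {i} {j} i<j s s' =
        wlog-< (λ i' j' → Slice id i' j' → Meet id i j i' j' → Aligned id i j i' j')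
               (λ h s' I → aligned-swapʳ (h (slice-sym s') (meet-swapʳ I)))
               (λ i'<j' s' I → inj₁ (sameDirection⇒sameDir (W₂ _ _ _ _ (i<j , s) (i'<j' , s') I)))
               (slice⇒≢ s') s'

  sliced⇒wellSliced : Sliced id → WellSliced D σ
  sliced⇒wellSliced S = intersectsExactlyOne , sameDirection
    where
      exactlyOne : ∀ {i j k p q} → p <ᶠ q → Adj k p q → Meet id i j p q →
                   (∀ i'' j'' → Adj k i'' j'' → Meet id i j i'' j'' → SamePair p q i'' j'') →
                   IntersectsExactlyOne D σ k i j
      exactlyOne {p = p} {q} p<q A I unique =
        p , q , ((p<q , A) , I) , λ { i'' j'' (i''<j'' , A'') I'' → samePair-< p<q i''<j'' (unique i'' j'' A'' I'') }

      intersectsExactlyOne : ∀ i j → IsSlice D σ i j → ∀ k → IntersectsExactlyOne D σ k i j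
      intersectsExactlyOne i j (_ , s) k with Sliced.meetsOne S i j s k
      ... | p , q , (A , I) , unique with <-cmp p q
      ...   | tri< p<q _ _ = exactlyOne {k = k} p<q A I unique
      ...   | tri≈ _ p≡q _ = ⊥-elim (adj⇒≢ {c = k} A p≡q)
      ...   | tri> _ _ q<p = exactlyOne {k = k} q<p (adj-sym {c = k} A) (meet-swapʳ I)
                               (λ i'' j'' A'' I'' → samePair-swapˡ (unique i'' j'' A'' I''))

      -- the first coordinate orders both slices, which rules out the reversed orientation
      sameDirection : ∀ i j i' j' → IsSlice D σ i j → IsSlice D σ i' j' → Intersect D σ i j i' j' →
                      SameDirection D σ i j i' j'
      sameDirection i j i' j' (i<j , s) (i'<j' , s') I with Sliced.aligned S i j i' j' s s' I
      ... | inj₁ f = sameDir⇒sameDirection f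
      ... | inj₂ f = ⊥-elim (sign-<≢sign-> i<j i'<j' (f zero))

module _ {d n e : ℕ} (σ : DPerm d n) (ι : Fin (suc e) → Fin d) where

  private
    ρ = coordPerm σ (ι zero)

    coords-proj : ∀ i k → coords (suc e) (proj σ ι) i k ≡ coords d σ (ρ ⟨$⟩ˡ i) (ι k)
    coords-proj i zero    = cong toℕ (sym (inverseʳ ρ))
    coords-proj i (suc k) = refl

    coords-proj⁻¹ : ∀ i k → coords d σ i (ι k) ≡ coords (suc e) (proj σ ι) (ρ ⟨$⟩ʳ i) k
    coords-proj⁻¹ i k = sym (trans (coords-proj (ρ ⟨$⟩ʳ i) k) (cong (λ x → coords d σ x (ι k)) (inverseˡ ρ)))

  wellSliced-proj⇔sliced : WellSliced (suc e) (proj σ ι) ⇔ Diagram.Sliced (coords d σ) ι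
  wellSliced-proj⇔sliced = mk⇔
    (λ W → sliced-relabel ρ coords-proj⁻¹ (wellSliced⇒sliced (proj σ ι) W))
    (λ S → sliced⇒wellSliced (proj σ ι) (sliced-relabel (flip ρ) coords-proj S))

module _ {d n : ℕ} (σ : DPerm d n)
         (H₂ : ∀ (ι : Fin 2 → Fin d) → StrictlyIncreasing ι → WellSliced 2 (proj σ ι))
         (H₃ : ∀ (ι : Fin 3 → Fin d) → StrictlyIncreasing ι → WellSliced 3 (proj σ ι)) where

  open Diagram (coords d σ)

  private
    sliced-pair : ∀ {a b} → a <ᶠ b → Sliced (pair a b)
    sliced-pair a<b = Equivalence.to (wellSliced-proj⇔sliced σ _) (H₂ _ (pair-increasing a<b))

    sliced-increasing : ∀ {a b c} → a <ᶠ b → b <ᶠ c → Sliced (triple a b c)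
    sliced-increasing a<b b<c = Equivalence.to (wellSliced-proj⇔sliced σ _) (H₃ _ (triple-increasing a<b b<c))

    sliced-pairWith : ∀ {a b c} → a <ᶠ b → c ≡ a ⊎ c ≡ b → Sliced (triple a b c)
    sliced-pairWith a<b c∈ = sliced-sameImage
      (λ { zero → inImage zero ; (suc zero) → inImage (suc zero) })
      (triple-⊆ᶜ (inImage zero) (inImage (suc zero)) (in-pair c∈))
      (sliced-pair a<b)
      where
        in-pair : ∀ {a b c} → c ≡ a ⊎ c ≡ b → InImage (pair a b) c
        in-pair (inj₁ e) = zero , sym e
        in-pair (inj₂ e) = suc zero , sym e

    sliced-< : ∀ {a b} c → a <ᶠ b → Sliced (triple a b c)
    sliced-< c a<b with <-cmp c _ | <-cmp c _
    ... | tri≈ _ c≡a _ | _            = sliced-pairWith a<b (inj₁ c≡a)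
    ... | _            | tri≈ _ c≡b _ = sliced-pairWith a<b (inj₂ c≡b)
    ... | tri< c<a _ _ | _            = sliced-sameImage
      (triple-⊆ᶜ (inImage (# 2)) (inImage (# 0)) (inImage (# 1)))
      (triple-⊆ᶜ (inImage (# 1)) (inImage (# 2)) (inImage (# 0)))
      (sliced-increasing c<a a<b)
    ... | tri> _ _ a<c | tri< c<b _ _ = sliced-sameImage
      (triple-⊆ᶜ (inImage (# 0)) (inImage (# 2)) (inImage (# 1)))
      (triple-⊆ᶜ (inImage (# 0)) (inImage (# 2)) (inImage (# 1)))
      (sliced-increasing a<c c<b)
    ... | tri> _ _ _   | tri> _ _ b<c = sliced-increasing a<b b<c

  sliced-triple : ∀ a b c → a ≢ b → Sliced (triple a b c)
  sliced-triple a b c = wlog-< (λ a b → Sliced (triple a b c)) swapped (sliced-< c)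
    where
      swapped : ∀ {a b} → Sliced (triple b a c) → Sliced (triple a b c)
      swapped = sliced-sameImage (triple-⊆ᶜ (inImage (# 1)) (inImage (# 0)) (inImage (# 2)))
                                 (triple-⊆ᶜ (inImage (# 1)) (inImage (# 0)) (inImage (# 2)))

  sliced-increasingAlong : ∀ e (ι : Fin (suc e) → Fin d) → StrictlyIncreasing ι → Sliced ι
  sliced-increasingAlong zero    ι _  = sliced-single (coords-injective σ) ι
  sliced-increasingAlong (suc e) ι ι↑ =
    sliced-fromTriples sliced-triple zero (suc zero)
                       (λ ι₀≡ι₁ → <-irrefl ι₀≡ι₁ (ι↑ zero (suc zero) (s≤s z≤n)))

corollary1 : ∀ (d n : ℕ) → 2 ≤ d → (σ : DPerm d n) →
    Baxter {d} σ ⇔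
      ((∀ (ι : Fin 2 → Fin d) → StrictlyIncreasing ι → WellSliced 2 (proj σ ι)) ×
       (∀ (ι : Fin 3 → Fin d) → StrictlyIncreasing ι → WellSliced 3 (proj σ ι)))
corollary1 d n _ σ = mk⇔
  (λ baxter → baxter 1 , baxter 2)
  (λ (H₂ , H₃) e ι ι↑ →
     Equivalence.from (wellSliced-proj⇔sliced σ ι) (sliced-increasingAlong σ H₂ H₃ e ι ι↑))
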